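{- Let $q\ge5$ be an odd prime power and $F=GF(q)$. Let $\Xi$ be the group of permutations of $F^*$ consisting of the maps $\xi^+_{\alpha,\tau}:f\mapsto\alpha f^{\tau}$ and $\xi^-_{\alpha,\tau}:f\mapsto\alpha (f^{\tau})^{ -1}$ for $\alpha\in F^*$, $\tau\in Aut(F)$. Let $B$ be the set of subsets of $F^*$ of size $\frac{q-1}{2}$; $\Xi$ acts on $B$ via $b\mapsto\{f^\xi:f\in b\}$. Let $\gamma$ be the permutation of $B$ given by $b^\gamma=F^*\setminus b$, and let $\Xi^*$ be the group of permutations of $B$ generated by (the permutations of $B$ induced by) $\Xi$ and $\gamma$. Then: (1) for all $\xi\in\Xi$, $\xi$ and $\gamma$ commute (as permutations of $B$); (2) $|\Xi^*|=2|\Xi|$; (3) for $\xi\in\Xi$, $\xi\gamma$ fixes some $b\in B$ if and only if all orbits of $\xi$ acting on $F^*$ have even length; (4) if all orbits of $\xi\in\Xi$ acting on $F^*$ have even length, then $\xi\gamma$ fixes exactly $2^{o(\xi)}$ elements of $B$, where $o(\xi)$ is the number of orbits of $\xi$ acting on $F^*$.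
   Context: $Aut(F)$ denotes the group of field automorphisms of $F$; $f^\tau$ denotes the image of $f$ under $\tau$. -}

module Defs where

open import Level using (0ℓ)
open import Data.Nat as ℕ using (ℕ; zero; suc; _∸_)
open import Data.Nat.Divisibility using (_∣_)
open import Data.Fin using (Fin)
open import Data.Fin.Properties using (any?; _≟_)
open import Data.Fin.Subset using (Subset; _∈_; _∉_; ∁; _∩_; ⁅_⁆; ∣_∣)
open import Data.Fin.Subset.Properties using (_∈?_)
open import Data.Bool using (Bool; true; false)
open import Data.Vec using (tabulate)
open import Data.Product using (Σ; ∃; ∃-syntax; _×_; _,_)
open import Relation.Nullary using (¬_; Dec; yes; no)
open import Relation.Nullary.Decidable using (⌊_⌋; _×-dec_)
open import Relation.Binary.PropositionalEquality using (_≡_; _≢_)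
open import Function.Definitions using (Injective; Surjective)
open import Algebra.Structures using (IsCommutativeRing)

-- A field whose carrier is Fin q (i.e. a field with exactly q elements),
-- with propositional equality.  Any finite field of order q is isomorphic
-- to one of this form, so this models GF(q).

record FieldOn (q : ℕ) : Set where
  field
    _+_ _*_ : Fin q → Fin q → Fin q
    -_      : Fin q → Fin q
    0# 1#   : Fin q
    _⁻¹     : Fin q → Fin q
    isCommutativeRing : IsCommutativeRing _≡_ _+_ _*_ -_ 0# 1#
    0≢1     : 0# ≢ 1#
    ⁻¹-inverse : ∀ x → x ≢ 0# → (x * (x ⁻¹)) ≡ 1#
  infixl 7 _*_
  infixl 6 _+_

module _ {q : ℕ} (F : FieldOn q) where
  open FieldOn F

  record Aut : Set where
    field
      τ       : Fin q → Fin q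
      τ-+     : ∀ x y → τ (x + y) ≡ τ x + τ y
      τ-*     : ∀ x y → τ (x * y) ≡ τ x * τ y
      τ-1     : τ 1# ≡ 1#
      τ-inj   : Injective _≡_ _≡_ τ
      τ-surj  : Surjective _≡_ _≡_ τ

  -- Parameters of the elements of Ξ:  ξ⁺_{α,τ} (sign true)
  -- and ξ⁻_{α,τ} (sign false), with α ∈ F*.
  record XiParam : Set where
    field
      α    : Fin q
      α≢0  : α ≢ 0#
      aut  : Aut
      sign : Bool

  -- The map f ↦ α f^τ  resp.  f ↦ α (f^τ)⁻¹  (only its values on F*
  -- are ever used).
  xiMap : XiParam → Fin q → Fin q
  xiMap record { α = α ; aut = τ ; sign = true  } f = α * Aut.τ τ f
  xiMap record { α = α ; aut = τ ; sign = false } f = α * (Aut.τ τ f ⁻¹)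

  _≈Ξ_ : XiParam → XiParam → Set
  ξ ≈Ξ ξ' = ∀ f → f ≢ 0# → xiMap ξ f ≡ xiMap ξ' f

  Fstar : Subset q
  Fstar = ∁ ⁅ 0# ⁆

  InB : Subset q → Set
  InB b = (0# ∉ b) × (∣ b ∣ ≡ ℕ._/_ (q ∸ 1) 2)

  image : (Fin q → Fin q) → Subset q → Subset q
  image g b = tabulate λ y → ⌊ any? (λ x → (x ∈? b) ×-dec (g x ≟ y)) ⌋

  actΞ : XiParam → Subset q → Subset q
  actΞ ξ b = image (xiMap ξ) b

  γ : Subset q → Subset q
  γ b = ∁ b ∩ Fstar

  -- ξγ (right-action convention: first ξ, then γ)
  actΞγ : XiParam → Subset q → Subset q
  actΞγ ξ b = γ (actΞ ξ b)

  -- Elements are represented by words in the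
  -- generators (a finite permutation group is the monoid generated by
  -- its generators, since inverses are positive powers).
  data Word : Set where
    idW  : Word
    genΞ : XiParam → Word
    genγ : Word
    _·_  : Word → Word → Word   -- w · w' : first w, then w'

  actW : Word → Subset q → Subset q
  actW idW      b = b
  actW (genΞ ξ) b = actΞ ξ b
  actW genγ     b = γ b
  actW (w · w') b = actW w' (actW w b)

  _≈W_ : Word → Word → Set
  w ≈W w' = ∀ b → InB b → actW w b ≡ actW w' b

  iter : (Fin q → Fin q) → ℕ → Fin q → Fin q
  iter g zero    x = x
  iter g (suc k) x = g (iter g k x)

  OrbitLength : XiParam → Fin q → ℕ → Set
  OrbitLength ξ f k =
    (1 ℕ.≤ k) × (iter (xiMap ξ) k f ≡ f)
      × (∀ j → 1 ℕ.≤ j → j ℕ.< k → iter (xiMap ξ) j f ≢ f)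

  AllOrbitsEven : XiParam → Set
  AllOrbitsEven ξ = ∀ f → f ≢ 0# → ∀ k → OrbitLength ξ f k → 2 ∣ k

  SameOrbit : XiParam → Fin q → Fin q → Set
  SameOrbit ξ f g = ∃[ k ] iter (xiMap ξ) k f ≡ g

record HasCard {A : Set} (S : A → Set) (_≈_ : A → A → Set) (n : ℕ) : Set where
  field
    elem     : Fin n → A
    elem∈S   : ∀ i → S (elem i)
    distinct : ∀ i j → elem i ≈ elem j → i ≡ j
    cover    : ∀ x → S x → ∃[ i ] (x ≈ elem i)

module Submission where

-- A subset b of F* is fixed by ξγ exactly when membership alternates along ξ: f ∈ b iff
-- ξ(f) ∉ b.  Along an orbit membership must then flip at every step, which is consistent
-- iff the orbit has even length; b is then determined by one free bit per orbit, which
-- gives 2^o(ξ) fixed sets, each of which automatically has (q - 1)/2 elements.  Every ξ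
-- permutes F*, so it commutes with complementation in F* and every element of Ξ* acts as
-- ξ or as ξγ.  These 2|Ξ| permutations of B are pairwise distinct because, for q ≥ 5, a
-- member of B can be chosen to contain one given point and avoid another, or to contain
-- two given points.

open import Level using (0ℓ)
open import Data.Nat as ℕ using (ℕ; zero; suc; _≤_; _^_; z≤n; s≤s)
import Data.Nat.Properties as ℕ
open import Data.Nat.Divisibility using (_∣_; divides; ∣m∣n⇒∣m+n)
open import Data.Nat.DivMod using (_%_; _/_; m≡m%n+[m/n]*n; m%n<n; m*n/n≡m; m/n<m; m/n≤m; /-monoˡ-≤)
open import Data.Nat.Induction using (<-rec)
open import Data.Nat.Primality using (Prime)
open import Data.Bool using (Bool; true; false; not; _∧_; _xor_; if_then_else_)
open import Data.Bool.Properties using (not-involutive; not-¬; ¬-not; ∧-identityʳ; T-≡)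
open import Data.Fin as Fin using (Fin; zero; suc; toℕ; fromℕ<; combine; remQuot; finToFun; funToFin)
open import Data.Fin.Properties
  using (all?; any?; pigeonhole; toℕ<n; toℕ-fromℕ<; 2↔Bool; remQuot-combine; combine-remQuot;
         finToFun-funToFin; funToFin-finToFin)
open import Data.Fin.Permutation using (Permutation′; _⟨$⟩ʳ_; permutation)
open import Data.Fin.Subset using (Subset; _∈_; _∉_; _⊆_; _∩_; _∪_; ∣_∣; ∁; ⁅_⁆; inside; outside)
open import Data.Fin.Subset.Properties
  using (out⊆; in⊆in; s⊆s; drop-∷-⊆; p⊆q⇒∣p∣≤∣q∣; x∈⁅x⁆; x∈⁅y⁆⇒x≡y; x∈p∩q⁺; x∈p∩q⁻; x∈p∪q⁺;
         x∈p∪q⁻; x∈∁p⇒x∉p; x∉p⇒x∈∁p; x∈p⇒x∉∁p; ∣∁p∣≡n∸∣p∣; ∣⁅x⁆∣≡1)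
open import Data.Vec using (Vec; []; _∷_; lookup; tabulate; replicate; here)
open import Data.Vec.Properties
  using (lookup∘tabulate; tabulate∘lookup; tabulate-cong; lookup-map; lookup-zipWith;
         lookup⇒[]=; []=⇒lookup)
open import Data.List as List using (List; length)
open import Data.List.Relation.Unary.Any as Any using (Any)
open import Data.List.Relation.Unary.Any.Properties using (concatMap⁺; map⁺)
open import Data.List.Relation.Unary.All as All using (All)
open import Data.List.Relation.Unary.AllPairs using (_∷_)
open import Data.List.Membership.Propositional.Properties using (∈-lookup; ∈-allFin)
import Data.List.Relation.Unary.Unique.DecSetoid as Unique
open import Data.List.Relation.Unary.Unique.DecSetoid.Properties using (deduplicate-!)
open import Data.List.Relation.Unary.Enumerates.Setoid using (IsEnumeration)
open import Data.List.Relation.Unary.Enumerates.Setoid.Properties using (deduplicate⁺; lookup-surjective)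
open import Data.Product using (Σ; ∃-syntax; _×_; _,_; proj₁; proj₂)
open import Data.Sum using (_⊎_; inj₁; inj₂; [_,_])
open import Data.Unit using (⊤; tt)
open import Data.Empty using (⊥; ⊥-elim)
open import Function using (_∘_)
open import Function.Bundles using (_↔_; _⇔_; Inverse; Equivalence; mk↔ₛ′; mk⇔)
open import Function.Properties.Inverse using (↔-sym)
open import Relation.Nullary using (¬_; ¬?; Dec; yes; no; contradiction; _×-dec_; _→-dec_)
open import Relation.Nullary.Decidable using (toWitness; fromWitness)
open import Relation.Unary using (Decidable)
open import Relation.Binary.Bundles using (DecSetoid)
open import Relation.Binary.PropositionalEquality
  using (_≡_; _≢_; refl; sym; trans; cong; cong₂; subst; subst₂; _≗_; module ≡-Reasoning)
open import Algebra.Bundles using (CommutativeRing)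
import Algebra.Properties.CommutativeSemigroup as CommutativeSemigroupProperties
import Algebra.Properties.Group as GroupProperties
open import Algebra.Properties.CommutativeMonoid.Sum ℕ.+-0-commutativeMonoid
  using (sum; sum-cong-≗; sum-permute; ∑-distrib-+)
open import Defs

notⁿ : ℕ → Bool → Bool
notⁿ zero    t = t
notⁿ (suc k) t = not (notⁿ k t)

notⁿ-+ : ∀ m n t → notⁿ (m ℕ.+ n) t ≡ notⁿ m (notⁿ n t)
notⁿ-+ zero    n t = refl
notⁿ-+ (suc m) n t = cong not (notⁿ-+ m n t)

notⁿ-even : ∀ {k} t → 2 ∣ k → notⁿ k t ≡ t
notⁿ-even t (divides m refl) = notⁿ-*2 m
  where
  notⁿ-*2 : ∀ m → notⁿ (m ℕ.* 2) t ≡ t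
  notⁿ-*2 zero    = refl
  notⁿ-*2 (suc m) = trans (not-involutive _) (notⁿ-*2 m)

k+k≡k*2 : ∀ k → k ℕ.+ k ≡ k ℕ.* 2
k+k≡k*2 k = trans (cong (k ℕ.+_) (sym (ℕ.+-identityʳ k))) (ℕ.*-comm 2 k)

notⁿ-involutive : ∀ k t → notⁿ k (notⁿ k t) ≡ t
notⁿ-involutive k t = trans (sym (notⁿ-+ k k t)) (notⁿ-even t (divides k (k+k≡k*2 k)))

notⁿ-fixed⇒even : ∀ k t → notⁿ k t ≡ t → 2 ∣ k
notⁿ-fixed⇒even zero          t _ = divides 0 refl
notⁿ-fixed⇒even (suc zero)    t e = contradiction (sym e) (not-¬ refl)
notⁿ-fixed⇒even (suc (suc k)) t e
  with divides m k≡m*2 ← notⁿ-fixed⇒even k t (trans (sym (not-involutive _)) e)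
  = divides (suc m) (cong (2 ℕ.+_) k≡m*2)

≡-fromTrue : ∀ {s t : Bool} → (s ≡ true → t ≡ true) → (t ≡ true → s ≡ true) → s ≡ t
≡-fromTrue {false} {false} _   _   = refl
≡-fromTrue {false} {true}  _   t⇒s = t⇒s refl
≡-fromTrue {true}  {false} s⇒t _   = sym (s⇒t refl)
≡-fromTrue {true}  {true}  _   _   = refl

lookup-extensional : ∀ {A : Set} {n} {u v : Vec A n} → (∀ i → lookup u i ≡ lookup v i) → u ≡ v
lookup-extensional {u = u} {v} u≗v =
  trans (sym (tabulate∘lookup u)) (trans (tabulate-cong u≗v) (tabulate∘lookup v))

χ : Bool → ℕ
χ true  = 1
χ false = 0

∣p∣≡∑χ : ∀ {n} (p : Subset n) → ∣ p ∣ ≡ sum (χ ∘ lookup p)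
∣p∣≡∑χ []            = refl
∣p∣≡∑χ (inside  ∷ p) = cong ℕ.suc (∣p∣≡∑χ p)
∣p∣≡∑χ (outside ∷ p) = ∣p∣≡∑χ p

∣∣-permute : ∀ {n} (p : Subset n) (π : Permutation′ n) → ∣ tabulate (lookup p ∘ (π ⟨$⟩ʳ_)) ∣ ≡ ∣ p ∣
∣∣-permute {n} p π = begin
  ∣ tabulate (lookup p ∘ (π ⟨$⟩ʳ_)) ∣                 ≡⟨ ∣p∣≡∑χ (tabulate (lookup p ∘ (π ⟨$⟩ʳ_))) ⟩
  sum (χ ∘ lookup (tabulate (lookup p ∘ (π ⟨$⟩ʳ_)))) ≡⟨ sum-cong-≗ {n} (cong χ ∘ lookup∘tabulate _) ⟩
  sum (χ ∘ lookup p ∘ (π ⟨$⟩ʳ_))                      ≡⟨ sym (sum-permute {n} (χ ∘ lookup p) π) ⟩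
  sum (χ ∘ lookup p)                                  ≡⟨ sym (∣p∣≡∑χ p) ⟩
  ∣ p ∣                                               ∎
  where open ≡-Reasoning

∣p∪q∣≤∣p∣+∣q∣ : ∀ {n} (p q : Subset n) → ∣ p ∪ q ∣ ≤ ∣ p ∣ ℕ.+ ∣ q ∣
∣p∪q∣≤∣p∣+∣q∣ []            []            = z≤n
∣p∪q∣≤∣p∣+∣q∣ (inside  ∷ p) (inside  ∷ q) =
  s≤s (ℕ.≤-trans (∣p∪q∣≤∣p∣+∣q∣ p q) (ℕ.+-monoʳ-≤ ∣ p ∣ (ℕ.n≤1+n ∣ q ∣)))
∣p∪q∣≤∣p∣+∣q∣ (inside  ∷ p) (outside ∷ q) = s≤s (∣p∪q∣≤∣p∣+∣q∣ p q)
∣p∪q∣≤∣p∣+∣q∣ (outside ∷ p) (inside  ∷ q) =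
  ℕ.≤-trans (s≤s (∣p∪q∣≤∣p∣+∣q∣ p q)) (ℕ.≤-reflexive (sym (ℕ.+-suc ∣ p ∣ ∣ q ∣)))
∣p∪q∣≤∣p∣+∣q∣ (outside ∷ p) (outside ∷ q) = ∣p∪q∣≤∣p∣+∣q∣ p q

∣⁅x⁆∪⁅y⁆∣≤2 : ∀ {n} (x y : Fin n) → ∣ ⁅ x ⁆ ∪ ⁅ y ⁆ ∣ ≤ 2
∣⁅x⁆∪⁅y⁆∣≤2 x y =
  ℕ.≤-trans (∣p∪q∣≤∣p∣+∣q∣ ⁅ x ⁆ ⁅ y ⁆) (ℕ.≤-reflexive (cong₂ ℕ._+_ (∣⁅x⁆∣≡1 x) (∣⁅x⁆∣≡1 y)))

⊆-interpolate : ∀ {n} (A C : Subset n) k → A ⊆ C → ∣ A ∣ ≤ k → k ≤ ∣ C ∣ →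
                ∃[ b ] (A ⊆ b × b ⊆ C × ∣ b ∣ ≡ k)
⊆-interpolate []            []            zero    _   _   _ = [] , (λ ()) , (λ ()) , refl
⊆-interpolate (inside  ∷ A) (outside ∷ C) k       A⊆C _   _ = contradiction (A⊆C here) λ ()
⊆-interpolate (inside  ∷ A) (inside  ∷ C) (suc k) A⊆C (s≤s ∣A∣≤k) (s≤s k≤∣C∣)
  with b , A⊆b , b⊆C , ∣b∣≡k ← ⊆-interpolate A C k (drop-∷-⊆ A⊆C) ∣A∣≤k k≤∣C∣
  = inside ∷ b , in⊆in A⊆b , in⊆in b⊆C , cong ℕ.suc ∣b∣≡k
⊆-interpolate (outside ∷ A) (outside ∷ C) k A⊆C ∣A∣≤k k≤∣C∣
  with b , A⊆b , b⊆C , ∣b∣≡k ← ⊆-interpolate A C k (drop-∷-⊆ A⊆C) ∣A∣≤k k≤∣C∣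
  = outside ∷ b , s⊆s A⊆b , s⊆s b⊆C , ∣b∣≡k
⊆-interpolate (outside ∷ A) (inside  ∷ C) k A⊆C ∣A∣≤k _ with k ℕ.≤? ∣ C ∣
... | yes k≤∣C∣
  with b , A⊆b , b⊆C , ∣b∣≡k ← ⊆-interpolate A C k (drop-∷-⊆ A⊆C) ∣A∣≤k k≤∣C∣
  = outside ∷ b , s⊆s A⊆b , out⊆ b⊆C , ∣b∣≡k
⊆-interpolate (outside ∷ A) (inside  ∷ C) zero    _   _ _         | no 0≰∣C∣ = contradiction z≤n 0≰∣C∣
⊆-interpolate (outside ∷ A) (inside  ∷ C) (suc k) A⊆C _ (s≤s k≤∣C∣) | no k+1≰∣C∣
  with b , A⊆b , b⊆C , ∣b∣≡k ← ⊆-interpolate A C k (drop-∷-⊆ A⊆C)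
         (ℕ.≤-pred (ℕ.≤-<-trans (p⊆q⇒∣p∣≤∣q∣ (drop-∷-⊆ A⊆C)) (ℕ.≰⇒> k+1≰∣C∣))) k≤∣C∣
  = inside ∷ b , out⊆ A⊆b , in⊆in b⊆C , cong ℕ.suc ∣b∣≡k

half-bounds : ∀ n → 5 ≤ n → 2 ≤ (n ℕ.∸ 1) / 2 × (n ℕ.∸ 1) / 2 ≤ n ℕ.∸ 2
half-bounds (suc (suc r)) (s≤s (s≤s 3≤r)) =
  /-monoˡ-≤ 2 (s≤s 3≤r) , ℕ.≤-pred (m/n<m (suc r) 2 (s≤s (s≤s z≤n)))

subtypeList : {A : Set} {P : A → Set} → Decidable P → List A → List (Σ A P)
subtypeList P? List.[]         = List.[]
subtypeList P? (x List.∷ xs) with P? x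
... | yes px = (x , px) List.∷ subtypeList P? xs
... | no  _  = subtypeList P? xs

∈-subtypeList : {A : Set} {P : A → Set} (P? : Decidable P) {x : A} {xs : List A} →
                Any (x ≡_) xs → P x → Any ((x ≡_) ∘ proj₁) (subtypeList P? xs)
∈-subtypeList P? {xs = y List.∷ ys} x∈xs px with P? y | x∈xs
... | yes _  | Any.here x≡y   = Any.here x≡y
... | yes _  | Any.there x∈ys = Any.there (∈-subtypeList P? x∈ys px)
... | no ¬py | Any.here refl  = contradiction px ¬py
... | no _   | Any.there x∈ys = ∈-subtypeList P? x∈ys px

module FiniteClasses {A : Set} (S : A → Set) (_≈_ : A → A → Set)
  (≈-refl  : ∀ {x} → S x → x ≈ x)
  (≈-sym   : ∀ {x y} → S x → x ≈ y → y ≈ x)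
  (≈-trans : ∀ {x y z} → x ≈ y → y ≈ z → x ≈ z)
  (≈-dec   : ∀ {x} → S x → ∀ y → Dec (x ≈ y))
  where

  classes : DecSetoid 0ℓ 0ℓ
  classes = record
    { Carrier          = Σ A S
    ; _≈_              = λ x y → proj₁ x ≈ proj₁ y
    ; isDecEquivalence = record
      { isEquivalence = record
        { refl  = λ {x} → ≈-refl (proj₂ x)
        ; sym   = λ {x} → ≈-sym (proj₂ x)
        ; trans = ≈-trans }
      ; _≟_ = λ x y → ≈-dec (proj₂ x) (proj₁ y) } }

  open DecSetoid classes using (_≟_; setoid)
  open Unique classes using (Unique)

  lookup-injective : ∀ {xs} → Unique xs → ∀ i j →
                     proj₁ (List.lookup xs i) ≈ proj₁ (List.lookup xs j) → i ≡ j
  lookup-injective {_ List.∷ _}  _            zero    zero    _  = refl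
  lookup-injective {_ List.∷ _}  (x≉xs ∷ _)   zero    (suc j) x≈ =
    contradiction x≈ (All.lookup x≉xs (∈-lookup j))
  lookup-injective {_ List.∷ xs} (x≉xs ∷ _)   (suc i) zero    x≈ =
    contradiction (≈-sym (proj₂ (List.lookup xs i)) x≈) (All.lookup x≉xs (∈-lookup i))
  lookup-injective {_ List.∷ _}  (_ ∷ unique) (suc i) (suc j) x≈ =
    cong suc (lookup-injective unique i j x≈)

  hasCard : (xs : List (Σ A S)) → IsEnumeration setoid xs → ∃[ n ] HasCard S _≈_ n
  hasCard xs enumerates = length ys , record
    { elem     = proj₁ ∘ List.lookup ys
    ; elem∈S   = proj₂ ∘ List.lookup ys
    ; distinct = lookup-injective (deduplicate-! classes xs)
    ; cover    = λ x Sx →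
        let i , lookup≈x = lookup-surjective setoid (deduplicate⁺ classes enumerates) (x , Sx)
        in i , ≈-sym (proj₂ (List.lookup ys i)) (lookup≈x refl) }
    where ys = List.deduplicate _≟_ xs

funToFin-cong : ∀ {m n} {f g : Fin m → Fin n} → f ≗ g → funToFin f ≡ funToFin g
funToFin-cong {zero}  _   = refl
funToFin-cong {suc m} f≗g = cong₂ combine (f≗g zero) (funToFin-cong (f≗g ∘ suc))

Vec-Bool↔Fin-2^ : ∀ o → Vec Bool o ↔ Fin (2 ^ o)
Vec-Bool↔Fin-2^ o = mk↔ₛ′ encode decode encode∘decode decode∘encode
  where
  open Inverse 2↔Bool using (to; from; strictlyInverseˡ; strictlyInverseʳ)
  encode : Vec Bool o → Fin (2 ^ o)
  encode c = funToFin (from ∘ lookup c)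
  decode : Fin (2 ^ o) → Vec Bool o
  decode i = tabulate (to ∘ finToFun {2} {o} i)
  encode∘decode : ∀ i → encode (decode i) ≡ i
  encode∘decode i = trans
    (funToFin-cong {o} {2} λ t → trans (cong from (lookup∘tabulate _ t)) (strictlyInverseʳ _))
    (funToFin-finToFin {o} {2} i)
  decode∘encode : ∀ c → decode (encode c) ≡ c
  decode∘encode c = trans
    (tabulate-cong λ t → trans (cong to (finToFun-funToFin _ t)) (strictlyInverseˡ _))
    (tabulate∘lookup c)

hasCard-↔ : ∀ {B A : Set} {S : A → Set} {n} (e : B ↔ Fin n) (φ : B → A) →
            (∀ c → S (φ c)) → (∀ {c c′} → φ c ≡ φ c′ → c ≡ c′) → (∀ x → S x → ∃[ c ] x ≡ φ c) →
            HasCard S _≡_ n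
hasCard-↔ e φ φ∈S φ-injective φ-covers = record
  { elem     = φ ∘ from
  ; elem∈S   = φ∈S ∘ from
  ; distinct = λ i j φi≡φj →
      trans (sym (strictlyInverseˡ i)) (trans (cong to (φ-injective φi≡φj)) (strictlyInverseˡ j))
  ; cover    = λ x Sx → let c , x≡φc = φ-covers x Sx in
      to c , trans x≡φc (cong φ (sym (strictlyInverseʳ c))) }
  where open Inverse e using (to; from; strictlyInverseˡ; strictlyInverseʳ)

hasCard-× : ∀ {C A B : Set} {_≈_ : A → A → Set} {_∼_ : B → B → Set} {m n}
            (e : C ↔ Fin m) (φ : C → A → B) → HasCard (λ _ → ⊤) _≈_ n →
            (∀ {c c′ x x′} → φ c x ∼ φ c′ x′ → c ≡ c′ × x ≈ x′) →
            (∀ y → ∃[ c ] ∃[ x ] y ∼ φ c x) →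
            (∀ {y c x x′} → y ∼ φ c x → x ≈ x′ → y ∼ φ c x′) →
            HasCard (λ _ → ⊤) _∼_ (m ℕ.* n)
hasCard-× {B = B} {_∼_ = _∼_} {m} {n} e φ H φ-injective φ-covers ∼-resp = record
  { elem     = elem
  ; elem∈S   = λ _ → tt
  ; distinct = distinct
  ; cover    = cover }
  where
  open Inverse e using (to; from; strictlyInverseˡ; strictlyInverseʳ)
  open HasCard H using () renaming (elem to elemᴬ; distinct to distinctᴬ; cover to coverᴬ)

  elem : Fin (m ℕ.* n) → B
  elem i = φ (from (proj₁ (remQuot {m} n i))) (elemᴬ (proj₂ (remQuot {m} n i)))

  distinct : ∀ i j → elem i ∼ elem j → i ≡ j
  distinct i j elemi∼elemj =
    let c≡c′ , x≈x′ = φ-injective elemi∼elemj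
        s≡s′ = trans (sym (strictlyInverseˡ _)) (trans (cong to c≡c′) (strictlyInverseˡ _))
    in trans (sym (combine-remQuot {m} n i))
             (trans (cong₂ combine s≡s′ (distinctᴬ _ _ x≈x′)) (combine-remQuot {m} n j))

  elem-combine : ∀ c j → elem (combine (to c) j) ≡ φ c (elemᴬ j)
  elem-combine c j = trans (cong (λ (s , j) → φ (from s) (elemᴬ j)) (remQuot-combine {m} (to c) j))
                           (cong (λ c → φ c (elemᴬ j)) (strictlyInverseʳ c))

  cover : ∀ y → ⊤ → ∃[ i ] y ∼ elem i
  cover y _ with c , x , y∼φcx ← φ-covers y with j , x≈elemj ← coverᴬ x tt =
    combine (to c) j , subst (y ∼_) (sym (elem-combine c j)) (∼-resp y∼φcx x≈elemj)

module FieldProperties {q : ℕ} (F : FieldOn q) where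

  open FieldOn F

  ring : CommutativeRing 0ℓ 0ℓ
  ring = record { isCommutativeRing = isCommutativeRing }

  open CommutativeRing ring using (*-comm; *-assoc; *-identityˡ; zeroʳ; *-commutativeSemigroup)
  open CommutativeSemigroupProperties *-commutativeSemigroup using (interchange)
  open ≡-Reasoning

  private variable x y z : Fin q

  1≢0 : 1# ≢ 0#
  1≢0 = 0≢1 ∘ sym

  ⁻¹-inverseˡ : x ≢ 0# → x ⁻¹ * x ≡ 1#
  ⁻¹-inverseˡ {x} x≢0 = trans (*-comm (x ⁻¹) x) (⁻¹-inverse x x≢0)

  *-cancelˡ : x ≢ 0# → x * y ≡ x * z → y ≡ z
  *-cancelˡ {x} {y} {z} x≢0 xy≡xz = begin
    y              ≡⟨ sym (*-identityˡ y) ⟩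
    1# * y         ≡⟨ cong (_* y) (sym (⁻¹-inverseˡ x≢0)) ⟩
    x ⁻¹ * x * y   ≡⟨ *-assoc _ _ _ ⟩
    x ⁻¹ * (x * y) ≡⟨ cong (x ⁻¹ *_) xy≡xz ⟩
    x ⁻¹ * (x * z) ≡⟨ sym (*-assoc _ _ _) ⟩
    x ⁻¹ * x * z   ≡⟨ cong (_* z) (⁻¹-inverseˡ x≢0) ⟩
    1# * z         ≡⟨ *-identityˡ z ⟩
    z              ∎

  *-nonzero : x ≢ 0# → y ≢ 0# → x * y ≢ 0#
  *-nonzero {x} x≢0 y≢0 xy≡0 = y≢0 (*-cancelˡ x≢0 (trans xy≡0 (sym (zeroʳ x))))

  ⁻¹-nonzero : x ≢ 0# → x ⁻¹ ≢ 0#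
  ⁻¹-nonzero {x} x≢0 x⁻¹≡0 = 0≢1 (begin
    0#       ≡⟨ sym (zeroʳ x) ⟩
    x * 0#   ≡⟨ cong (x *_) (sym x⁻¹≡0) ⟩
    x * x ⁻¹ ≡⟨ ⁻¹-inverse x x≢0 ⟩
    1#       ∎)

  ⁻¹-unique : x ≢ 0# → x * y ≡ 1# → y ≡ x ⁻¹
  ⁻¹-unique {x} x≢0 xy≡1 = *-cancelˡ x≢0 (trans xy≡1 (sym (⁻¹-inverse x x≢0)))

  ⁻¹-involutive : x ≢ 0# → x ⁻¹ ⁻¹ ≡ x
  ⁻¹-involutive x≢0 = sym (⁻¹-unique (⁻¹-nonzero x≢0) (⁻¹-inverseˡ x≢0))

  ⁻¹-distrib-* : x ≢ 0# → y ≢ 0# → (x * y) ⁻¹ ≡ x ⁻¹ * y ⁻¹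
  ⁻¹-distrib-* {x} {y} x≢0 y≢0 = sym (⁻¹-unique (*-nonzero x≢0 y≢0) (begin
    x * y * (x ⁻¹ * y ⁻¹) ≡⟨ interchange x y (x ⁻¹) (y ⁻¹) ⟩
    x * x ⁻¹ * (y * y ⁻¹) ≡⟨ cong₂ _*_ (⁻¹-inverse x x≢0) (⁻¹-inverse y y≢0) ⟩
    1# * 1#               ≡⟨ *-identityˡ 1# ⟩
    1#                    ∎))

  *-⁻¹-cancelˡ : x ≢ 0# → x * (x ⁻¹ * y) ≡ y
  *-⁻¹-cancelˡ {x} {y} x≢0 = begin
    x * (x ⁻¹ * y) ≡⟨ sym (*-assoc _ _ _) ⟩
    x * x ⁻¹ * y   ≡⟨ cong (_* y) (⁻¹-inverse x x≢0) ⟩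
    1# * y         ≡⟨ *-identityˡ y ⟩
    y              ∎

  nonzeros : List (Σ (Fin q) (_≢ 0#))
  nonzeros = subtypeList (λ x → ¬? (x Fin.≟ 0#)) (List.allFin q)

  ∈-nonzeros : x ≢ 0# → Any ((x ≡_) ∘ proj₁) nonzeros
  ∈-nonzeros {x} = ∈-subtypeList (λ x → ¬? (x Fin.≟ 0#)) (∈-allFin x)

  signed : Bool → Fin q → Fin q
  signed true  x = x
  signed false x = x ⁻¹

  signed-nonzero : ∀ s → x ≢ 0# → signed s x ≢ 0#
  signed-nonzero true  x≢0 = x≢0
  signed-nonzero false x≢0 = ⁻¹-nonzero x≢0

  signed-involutive : ∀ s → x ≢ 0# → signed s (signed s x) ≡ x
  signed-involutive true  _   = refl
  signed-involutive false x≢0 = ⁻¹-involutive x≢0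

  signed-injective : ∀ s → x ≢ 0# → y ≢ 0# → signed s x ≡ signed s y → x ≡ y
  signed-injective s x≢0 y≢0 sx≡sy =
    trans (sym (signed-involutive s x≢0)) (trans (cong (signed s) sx≡sy) (signed-involutive s y≢0))

  signed-* : ∀ s → x ≢ 0# → y ≢ 0# → signed s (x * y) ≡ signed s x * signed s y
  signed-* true  _   _   = refl
  signed-* false x≢0 y≢0 = ⁻¹-distrib-* x≢0 y≢0

  signed-signed : ∀ s t → x ≢ 0# → signed t (signed s x) ≡ signed (if t then s else not s) x
  signed-signed s     true  _   = refl
  signed-signed true  false _   = refl
  signed-signed false false x≢0 = ⁻¹-involutive x≢0

module AutomorphismProperties {q : ℕ} {F : FieldOn q} (σ : Aut F) where

  open FieldOn F
  open FieldProperties F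
  open CommutativeRing ring using (+-identityʳ; +-group)
  open GroupProperties +-group using (identityʳ-unique)
  open Aut σ

  private variable x : Fin q

  τ-0 : τ 0# ≡ 0#
  τ-0 = identityʳ-unique (τ 0#) (τ 0#) (trans (sym (τ-+ 0# 0#)) (cong τ (+-identityʳ 0#)))

  τ-nonzero : x ≢ 0# → τ x ≢ 0#
  τ-nonzero x≢0 τx≡0 = x≢0 (τ-inj (trans τx≡0 (sym τ-0)))

  τ-⁻¹ : x ≢ 0# → τ (x ⁻¹) ≡ τ x ⁻¹
  τ-⁻¹ {x} x≢0 = ⁻¹-unique (τ-nonzero x≢0) (begin
    τ x * τ (x ⁻¹) ≡⟨ sym (τ-* x (x ⁻¹)) ⟩
    τ (x * x ⁻¹)   ≡⟨ cong τ (⁻¹-inverse x x≢0) ⟩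
    τ 1#           ≡⟨ τ-1 ⟩
    1#             ∎)
    where open ≡-Reasoning

  τ-signed : ∀ s → x ≢ 0# → τ (signed s x) ≡ signed s (τ x)
  τ-signed true  _   = refl
  τ-signed false x≢0 = τ-⁻¹ x≢0

module _ {q : ℕ} {F : FieldOn q} where

  idᴬ : Aut F
  idᴬ = record
    { τ = λ x → x ; τ-+ = λ _ _ → refl ; τ-* = λ _ _ → refl ; τ-1 = refl
    ; τ-inj = λ x≡y → x≡y ; τ-surj = λ y → y , λ z≡y → z≡y }

  infixr 9 _⨾ᴬ_
  _⨾ᴬ_ : Aut F → Aut F → Aut F
  σ ⨾ᴬ ρ = record
    { τ      = τρ ∘ τσ
    ; τ-+    = λ x y → trans (cong τρ (Aut.τ-+ σ x y)) (Aut.τ-+ ρ _ _)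
    ; τ-*    = λ x y → trans (cong τρ (Aut.τ-* σ x y)) (Aut.τ-* ρ _ _)
    ; τ-1    = trans (cong τρ (Aut.τ-1 σ)) (Aut.τ-1 ρ)
    ; τ-inj  = Aut.τ-inj σ ∘ Aut.τ-inj ρ
    ; τ-surj = λ z → let y , τρy≡z = Aut.τ-surj ρ z ; x , τσx≡y = Aut.τ-surj σ y
                     in x , τρy≡z ∘ τσx≡y }
    where
    τσ = Aut.τ σ
    τρ = Aut.τ ρ

record PermutesF* {q : ℕ} (F : FieldOn q) (g : Fin q → Fin q) : Set where
  open FieldOn F using (0#)
  field
    nonzero    : ∀ {x} → x ≢ 0# → g x ≢ 0#
    injective  : ∀ {x y} → x ≢ 0# → y ≢ 0# → g x ≡ g y → x ≡ y
    surjective : ∀ {y} → y ≢ 0# → ∃[ x ] (x ≢ 0# × g x ≡ y)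

module XiProperties {q : ℕ} (F : FieldOn q) where

  open FieldOn F
  open FieldProperties F
  open XiParam
  open Aut
  open ≡-Reasoning

  private variable f : Fin q

  xiMap-signed : ∀ ξ f → xiMap F ξ f ≡ α ξ * signed (sign ξ) (τ (aut ξ) f)
  xiMap-signed record { sign = true  } f = refl
  xiMap-signed record { sign = false } f = refl

  xiMap-permutes : ∀ ξ → PermutesF* F (xiMap F ξ)
  xiMap-permutes ξ = record { nonzero = nonzero ; injective = injective ; surjective = surjective }
    where
    open AutomorphismProperties (aut ξ)
    s = sign ξ

    nonzero : f ≢ 0# → xiMap F ξ f ≢ 0#
    nonzero {f} f≢0 =
      subst (_≢ 0#) (sym (xiMap-signed ξ f)) (*-nonzero (α≢0 ξ) (signed-nonzero s (τ-nonzero f≢0)))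

    injective : ∀ {f f′} → f ≢ 0# → f′ ≢ 0# → xiMap F ξ f ≡ xiMap F ξ f′ → f ≡ f′
    injective {f} {f′} f≢0 f′≢0 ξf≡ξf′ = τ-inj (aut ξ)
      (signed-injective s (τ-nonzero f≢0) (τ-nonzero f′≢0)
        (*-cancelˡ (α≢0 ξ) (trans (sym (xiMap-signed ξ f)) (trans ξf≡ξf′ (xiMap-signed ξ f′)))))

    surjective : ∀ {y} → y ≢ 0# → ∃[ x ] (x ≢ 0# × xiMap F ξ x ≡ y)
    surjective {y} y≢0 = x , x≢0 , (begin
      xiMap F ξ x                            ≡⟨ xiMap-signed ξ x ⟩
      α ξ * signed s (τ (aut ξ) x)           ≡⟨ cong (λ z → α ξ * signed s z) τx≡ ⟩
      α ξ * signed s (signed s (α ξ ⁻¹ * y)) ≡⟨ cong (α ξ *_) (signed-involutive s α⁻¹y≢0) ⟩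
      α ξ * (α ξ ⁻¹ * y)                     ≡⟨ *-⁻¹-cancelˡ (α≢0 ξ) ⟩
      y                                      ∎)
      where
      α⁻¹y≢0 = *-nonzero (⁻¹-nonzero (α≢0 ξ)) y≢0
      x = proj₁ (τ-surj (aut ξ) (signed s (α ξ ⁻¹ * y)))
      τx≡ : τ (aut ξ) x ≡ signed s (α ξ ⁻¹ * y)
      τx≡ = proj₂ (τ-surj (aut ξ) _) refl
      x≢0 : x ≢ 0#
      x≢0 x≡0 = signed-nonzero s α⁻¹y≢0 (trans (sym τx≡) (trans (cong (τ (aut ξ)) x≡0) τ-0))

  idΞ : XiParam F
  idΞ = record { α = 1# ; α≢0 = 1≢0 ; aut = idᴬ ; sign = true }

  xiMap-idΞ : ∀ f → xiMap F idΞ f ≡ f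
  xiMap-idΞ = CommutativeRing.*-identityˡ ring

  infixr 9 _⨾_
  _⨾_ : XiParam F → XiParam F → XiParam F
  ξ ⨾ η = record
    { α    = α η * signed (sign η) (τ (aut η) (α ξ))
    ; α≢0  = *-nonzero (α≢0 η) (signed-nonzero (sign η) (τ-nonzero (α≢0 ξ)))
    ; aut  = aut ξ ⨾ᴬ aut η
    ; sign = if sign η then sign ξ else not (sign ξ) }
    where open AutomorphismProperties (aut η)

  xiMap-⨾ : ∀ ξ η → f ≢ 0# → xiMap F (ξ ⨾ η) f ≡ xiMap F η (xiMap F ξ f)
  xiMap-⨾ {f} ξ η f≢0 = begin
    xiMap F (ξ ⨾ η) f
      ≡⟨ xiMap-signed (ξ ⨾ η) f ⟩
    α η * sη (τη (α ξ)) * signed (sign (ξ ⨾ η)) (τη (τξ f))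
      ≡⟨ CommutativeRing.*-assoc ring _ _ _ ⟩
    α η * (sη (τη (α ξ)) * signed (sign (ξ ⨾ η)) (τη (τξ f)))
      ≡⟨ cong (λ z → α η * (sη (τη (α ξ)) * z)) (sym (signed-signed (sign ξ) (sign η) τητξf≢0)) ⟩
    α η * (sη (τη (α ξ)) * sη (sξ (τη (τξ f))))
      ≡⟨ cong (λ z → α η * (sη (τη (α ξ)) * sη z)) (sym (η.τ-signed (sign ξ) (ξ.τ-nonzero f≢0))) ⟩
    α η * (sη (τη (α ξ)) * sη (τη (sξ (τξ f))))
      ≡⟨ cong (α η *_) (sym (signed-* (sign η) (η.τ-nonzero (α≢0 ξ)) (η.τ-nonzero sξτξf≢0))) ⟩
    α η * sη (τη (α ξ) * τη (sξ (τξ f)))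
      ≡⟨ cong (λ z → α η * sη z) (sym (τ-* (aut η) _ _)) ⟩
    α η * sη (τη (α ξ * sξ (τξ f)))
      ≡⟨ cong (λ z → α η * sη (τη z)) (sym (xiMap-signed ξ f)) ⟩
    α η * sη (τη (xiMap F ξ f))
      ≡⟨ sym (xiMap-signed η _) ⟩
    xiMap F η (xiMap F ξ f)
      ∎
    where
    module ξ = AutomorphismProperties (aut ξ)
    module η = AutomorphismProperties (aut η)
    τξ = τ (aut ξ)
    τη = τ (aut η)
    sξ = signed (sign ξ)
    sη = signed (sign η)
    sξτξf≢0 = signed-nonzero (sign ξ) (ξ.τ-nonzero f≢0)
    τητξf≢0 = η.τ-nonzero (ξ.τ-nonzero f≢0)

module XiEnumeration {q : ℕ} (F : FieldOn q) where

  open FieldOn F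
  open FieldProperties F using (signed; nonzeros; ∈-nonzeros)
  open XiProperties F using (xiMap-signed)
  open XiParam
  open Aut

  IsAutomorphism : (Fin q → Fin q) → Set
  IsAutomorphism f = (∀ x y → f (x + y) ≡ f x + f y) × (∀ x y → f (x * y) ≡ f x * f y) × f 1# ≡ 1#
                   × (∀ x y → f x ≡ f y → x ≡ y) × (∀ y → ∃[ x ] f x ≡ y)

  isAutomorphism? : ∀ f → Dec (IsAutomorphism f)
  isAutomorphism? f = all? (λ x → all? λ y → f (x + y) Fin.≟ f x + f y)
               ×-dec all? (λ x → all? λ y → f (x * y) Fin.≟ f x * f y)
               ×-dec f 1# Fin.≟ 1#
               ×-dec all? (λ x → all? λ y → (f x Fin.≟ f y) →-dec (x Fin.≟ y))
               ×-dec all? (λ y → any? λ x → f x Fin.≟ y)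

  toAut : ∀ {f} → IsAutomorphism f → Aut F
  toAut {f} (+-hom , *-hom , 1-hom , inj , surj) = record
    { τ = f ; τ-+ = +-hom ; τ-* = *-hom ; τ-1 = 1-hom ; τ-inj = inj _ _
    ; τ-surj = λ y → let x , fx≡y = surj y in x , λ z≡x → trans (cong f z≡x) fx≡y }

  isAutomorphism : (σ : Aut F) → IsAutomorphism (τ σ)
  isAutomorphism σ =
    τ-+ σ , τ-* σ , τ-1 σ , (λ _ _ → τ-inj σ) , λ y → let x , τx≡y = τ-surj σ y in x , τx≡y refl

  IsAutomorphism-resp : ∀ {f g} → f ≗ g → IsAutomorphism g → IsAutomorphism f
  IsAutomorphism-resp {f} {g} f≗g (+-hom , *-hom , 1-hom , inj , surj) =
      (λ x y → trans (f≗g _) (trans (+-hom x y) (sym (cong₂ _+_ (f≗g x) (f≗g y)))))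
    , (λ x y → trans (f≗g _) (trans (*-hom x y) (sym (cong₂ _*_ (f≗g x) (f≗g y)))))
    , trans (f≗g 1#) 1-hom
    , (λ x y fx≡fy → inj x y (trans (sym (f≗g x)) (trans fx≡fy (f≗g y))))
    , λ y → let x , gx≡y = surj y in x , trans (f≗g x) gx≡y

  automorphismsWith : (Fin q → Fin q) → List (Aut F)
  automorphismsWith f with isAutomorphism? f
  ... | yes isAut = List.[ toAut isAut ]
  ... | no  _     = List.[]

  automorphismsWith-complete : ∀ {f} (σ : Aut F) → f ≗ τ σ → Any (λ ρ → τ ρ ≗ τ σ) (automorphismsWith f)
  automorphismsWith-complete {f} σ f≗τσ with isAutomorphism? f
  ... | yes _      = Any.here f≗τσ
  ... | no  ¬isAut = contradiction (IsAutomorphism-resp f≗τσ (isAutomorphism σ)) ¬isAut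

  -- Candidates are all q ^ q maps Fin q → Fin q, listed through their codes finToFun i.
  automorphisms : List (Aut F)
  automorphisms = List.concatMap (automorphismsWith ∘ finToFun) (List.allFin (q ^ q))

  automorphisms-complete : (σ : Aut F) → Any (λ ρ → τ ρ ≗ τ σ) automorphisms
  automorphisms-complete σ = concatMap⁺ _ (Any.map
    (λ { refl → automorphismsWith-complete σ (finToFun-funToFin (τ σ)) })
    (∈-allFin (funToFin (τ σ))))

  xiWith : Σ (Fin q) (_≢ 0#) → Aut F → Bool → XiParam F
  xiWith (a , a≢0) σ s = record { α = a ; α≢0 = a≢0 ; aut = σ ; sign = s }

  signs : List Bool
  signs = true List.∷ false List.∷ List.[]

  xis : List (XiParam F)
  xis = List.concatMap (λ a → List.concatMap (λ σ → List.map (xiWith a σ) signs) automorphisms) nonzeros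

  ≈Ξ-intro : ∀ ξ η → α ξ ≡ α η → sign ξ ≡ sign η → τ (aut η) ≗ τ (aut ξ) → _≈Ξ_ F ξ η
  ≈Ξ-intro ξ η α≡ sign≡ τ≗ f _ = trans (xiMap-signed ξ f)
    (trans (cong₂ _*_ α≡ (cong₂ signed sign≡ (sym (τ≗ f)))) (sym (xiMap-signed η f)))

  xis-complete : ∀ ξ → Any (_≈Ξ_ F ξ) xis
  xis-complete ξ =
    concatMap⁺ _ (Any.map (λ {a} α≡ →
      concatMap⁺ _ (Any.map (λ {σ} τ≗ →
        map⁺ {f = xiWith a σ} (Any.map (λ {s} sign≡ → ≈Ξ-intro ξ (xiWith a σ s) α≡ sign≡ τ≗)
                                       (sign-listed (sign ξ))))
        (automorphisms-complete (aut ξ))))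
      (∈-nonzeros (α≢0 ξ)))
    where
    sign-listed : ∀ s → Any (s ≡_) signs
    sign-listed true  = Any.here refl
    sign-listed false = Any.there (Any.here refl)

  Ξ-classes : ∃[ n ] HasCard (λ _ → ⊤) (_≈Ξ_ F) n
  Ξ-classes = hasCard (List.map (_, tt) xis) (λ (ξ , _) → map⁺ (xis-complete ξ))
    where
    open FiniteClasses (λ _ → ⊤) (_≈Ξ_ F)
      (λ _ _ _ → refl)
      (λ _ ξ≈η f f≢0 → sym (ξ≈η f f≢0))
      (λ ξ≈η η≈θ f f≢0 → trans (ξ≈η f f≢0) (η≈θ f f≢0))
      (λ {ξ} _ η → all? λ f → ¬? (f Fin.≟ 0#) →-dec (xiMap F ξ f Fin.≟ xiMap F η f))

module SubsetsOfF* {q : ℕ} (F : FieldOn q) where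

  open FieldOn F using (0#)
  open ≡-Reasoning

  private variable
    b c u v : Subset q
    x y : Fin q
    g h : Fin q → Fin q

  ∉⇒lookup≡false : x ∉ b → lookup b x ≡ false
  ∉⇒lookup≡false {x} {b} x∉b = ¬-not (x∉b ∘ lookup⇒[]= x b)

  lookup≡true⇒nonzero : 0# ∉ b → lookup b x ≡ true → x ≢ 0#
  lookup≡true⇒nonzero {b} 0∉b bx≡true refl = 0∉b (lookup⇒[]= 0# b bx≡true)

  ≡-onF* : 0# ∉ u → 0# ∉ v → (∀ {y} → y ≢ 0# → lookup u y ≡ lookup v y) → u ≡ v
  ≡-onF* {u} {v} 0∉u 0∉v agree = lookup-extensional agree′
    where
    agree′ : ∀ y → lookup u y ≡ lookup v y
    agree′ y with y Fin.≟ 0#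
    ... | yes refl = trans (∉⇒lookup≡false 0∉u) (sym (∉⇒lookup≡false 0∉v))
    ... | no  y≢0  = agree y≢0

  image⁺ : lookup b x ≡ true → g x ≡ y → lookup (image F g b) y ≡ true
  image⁺ {b} {x} {g} {y} bx≡true gx≡y =
    trans (lookup∘tabulate _ y) (Equivalence.to T-≡ (fromWitness (x , lookup⇒[]= x b bx≡true , gx≡y)))

  image⁻ : lookup (image F g b) y ≡ true → ∃[ x ] (lookup b x ≡ true × g x ≡ y)
  image⁻ {g} {b} {y} img≡true =
    let x , x∈b , gx≡y = toWitness (Equivalence.from T-≡ (trans (sym (lookup∘tabulate _ y)) img≡true))
    in x , []=⇒lookup x∈b , gx≡y

  image-cong : 0# ∉ b → (∀ {x} → x ≢ 0# → g x ≡ h x) → image F g b ≡ image F h b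
  image-cong {b} 0∉b g≗h = lookup-extensional λ y → ≡-fromTrue
    (λ img≡true → let x , bx , gx≡y = image⁻ img≡true in
      image⁺ bx (trans (sym (g≗h (lookup≡true⇒nonzero 0∉b bx))) gx≡y))
    (λ img≡true → let x , bx , hx≡y = image⁻ img≡true in
      image⁺ bx (trans (g≗h (lookup≡true⇒nonzero 0∉b bx)) hx≡y))

  image-∘ : image F h (image F g b) ≡ image F (h ∘ g) b
  image-∘ {h} = lookup-extensional λ y → ≡-fromTrue
    (λ img≡true → let z , imgz , hz≡y = image⁻ img≡true ; x , bx , gx≡z = image⁻ imgz in
      image⁺ bx (trans (cong h gx≡z) hz≡y))
    (λ img≡true → let x , bx , hgx≡y = image⁻ img≡true in image⁺ (image⁺ bx refl) hgx≡y)

  image-id : image F (λ x → x) b ≡ b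
  image-id {b} = lookup-extensional λ y → ≡-fromTrue
    (λ img≡true → let x , bx , x≡y = image⁻ img≡true in subst (λ z → lookup b z ≡ true) x≡y bx)
    (λ by≡true → image⁺ by≡true refl)

  0∉F* : 0# ∉ Fstar F
  0∉F* = x∈p⇒x∉∁p (x∈⁅x⁆ 0#)

  ∈F*⁺ : y ≢ 0# → y ∈ Fstar F
  ∈F*⁺ y≢0 = x∉p⇒x∈∁p (y≢0 ∘ x∈⁅y⁆⇒x≡y 0#)

  lookup-F* : y ≢ 0# → lookup (Fstar F) y ≡ true
  lookup-F* {y} y≢0 = []=⇒lookup (∈F*⁺ y≢0)

  ∣F*∣ : ∣ Fstar F ∣ ≡ q ℕ.∸ 1
  ∣F*∣ = trans (∣∁p∣≡n∸∣p∣ ⁅ 0# ⁆) (cong (q ℕ.∸_) (∣⁅x⁆∣≡1 0#))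

  ⁅x⁆∪⁅y⁆⊆F* : x ≢ 0# → y ≢ 0# → ⁅ x ⁆ ∪ ⁅ y ⁆ ⊆ Fstar F
  ⁅x⁆∪⁅y⁆⊆F* {x} {y} x≢0 y≢0 z∈ = ∈F*⁺ ([ (λ z∈⁅x⁆ → subst (_≢ 0#) (sym (x∈⁅y⁆⇒x≡y x z∈⁅x⁆)) x≢0)
                                         , (λ z∈⁅y⁆ → subst (_≢ 0#) (sym (x∈⁅y⁆⇒x≡y y z∈⁅y⁆)) y≢0)
                                         ] (x∈p∪q⁻ ⁅ x ⁆ ⁅ y ⁆ z∈))

  lookup-γ : ∀ c → y ≢ 0# → lookup (γ F c) y ≡ not (lookup c y)
  lookup-γ {y} c y≢0 = begin
    lookup (∁ c ∩ Fstar F) y            ≡⟨ lookup-zipWith _∧_ y (∁ c) (Fstar F) ⟩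
    lookup (∁ c) y ∧ lookup (Fstar F) y ≡⟨ cong₂ _∧_ (lookup-map y not c) (lookup-F* y≢0) ⟩
    not (lookup c y) ∧ true             ≡⟨ ∧-identityʳ _ ⟩
    not (lookup c y)                    ∎

  ∈γ⁺ : y ≢ 0# → y ∉ c → y ∈ γ F c
  ∈γ⁺ y≢0 y∉c = x∈p∩q⁺ (x∉p⇒x∈∁p y∉c , ∈F*⁺ y≢0)

  ∈γ⁻ : y ∈ γ F c → y ∉ c
  ∈γ⁻ {c = c} y∈γc = x∈∁p⇒x∉p (proj₁ (x∈p∩q⁻ (∁ c) (Fstar F) y∈γc))

  0∉γ : 0# ∉ γ F c
  0∉γ {c} 0∈γc = 0∉F* (proj₂ (x∈p∩q⁻ (∁ c) (Fstar F) 0∈γc))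

  γ-involutive : 0# ∉ c → γ F (γ F c) ≡ c
  γ-involutive {c} 0∉c = ≡-onF* 0∉γ 0∉c λ y≢0 →
    trans (lookup-γ (γ F c) y≢0) (trans (cong not (lookup-γ c y≢0)) (not-involutive _))

  ∣γ∣+∣∣≡∣F*∣ : 0# ∉ c → ∣ γ F c ∣ ℕ.+ ∣ c ∣ ≡ q ℕ.∸ 1
  ∣γ∣+∣∣≡∣F*∣ {c} 0∉c = begin
    ∣ γ F c ∣ ℕ.+ ∣ c ∣                                 ≡⟨ cong₂ ℕ._+_ (∣p∣≡∑χ (γ F c)) (∣p∣≡∑χ c) ⟩
    sum (χ ∘ lookup (γ F c)) ℕ.+ sum (χ ∘ lookup c)     ≡⟨ sym (∑-distrib-+ _ (χ ∘ lookup c)) ⟩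
    sum (λ y → χ (lookup (γ F c) y) ℕ.+ χ (lookup c y)) ≡⟨ sum-cong-≗ {q} pointwise ⟩
    sum (χ ∘ lookup (Fstar F))                          ≡⟨ sym (∣p∣≡∑χ (Fstar F)) ⟩
    ∣ Fstar F ∣                                         ≡⟨ ∣F*∣ ⟩
    q ℕ.∸ 1                                             ∎
    where
    χ-not : ∀ t → χ (not t) ℕ.+ χ t ≡ 1
    χ-not true  = refl
    χ-not false = refl
    pointwise : ∀ y → χ (lookup (γ F c) y) ℕ.+ χ (lookup c y) ≡ χ (lookup (Fstar F) y)
    pointwise y with y Fin.≟ 0#
    ... | yes refl = trans (cong₂ (λ s t → χ s ℕ.+ χ t) (∉⇒lookup≡false (0∉γ {c})) (∉⇒lookup≡false 0∉c))
                           (cong χ (sym (∉⇒lookup≡false 0∉F*)))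
    ... | no  y≢0  = trans (cong (λ s → χ s ℕ.+ χ (lookup c y)) (lookup-γ c y≢0))
                           (trans (χ-not (lookup c y)) (cong χ (sym (lookup-F* y≢0))))

  fixing0 : (Fin q → Fin q) → Fin q → Fin q
  fixing0 g y with y Fin.≟ 0#
  ... | yes _ = 0#
  ... | no  _ = g y

  fixing0-inverse : (∀ {x} → x ≢ 0# → h x ≢ 0#) → (∀ {x} → x ≢ 0# → g (h x) ≡ x) →
                    ∀ y → fixing0 g (fixing0 h y) ≡ y
  fixing0-inverse {h} {g} h-nonzero g∘h y with y Fin.≟ 0#
  ... | yes refl = fixing0-0
    where
    fixing0-0 : fixing0 g 0# ≡ 0#
    fixing0-0 with 0# Fin.≟ 0#
    ... | yes _   = refl
    ... | no  0≢0 = contradiction refl 0≢0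
  ... | no  y≢0 with h y Fin.≟ 0#
  ...   | yes hy≡0 = contradiction hy≡0 (h-nonzero y≢0)
  ...   | no  _    = g∘h y≢0

  module _ (g-permutes : PermutesF* F g) where

    open PermutesF* g-permutes

    0∉image : 0# ∉ b → 0# ∉ image F g b
    0∉image {b} 0∉b 0∈img = let x , bx , gx≡0 = image⁻ ([]=⇒lookup 0∈img) in
      nonzero (lookup≡true⇒nonzero 0∉b bx) gx≡0

    lookup-image : 0# ∉ b → x ≢ 0# → lookup (image F g b) (g x) ≡ lookup b x
    lookup-image {b} {x} 0∉b x≢0 = ≡-fromTrue
      (λ img≡true → let x′ , bx′ , gx′≡gx = image⁻ img≡true in
        subst (λ z → lookup b z ≡ true) (injective (lookup≡true⇒nonzero 0∉b bx′) x≢0 gx′≡gx) bx′)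
      (λ bx≡true → image⁺ bx≡true refl)

    ≡-along : 0# ∉ u → 0# ∉ v → (∀ {x} → x ≢ 0# → lookup u (g x) ≡ lookup v (g x)) → u ≡ v
    ≡-along {u} {v} 0∉u 0∉v agree = ≡-onF* 0∉u 0∉v λ y≢0 →
      let x , x≢0 , gx≡y = surjective y≢0 in subst (λ y → lookup u y ≡ lookup v y) gx≡y (agree x≢0)

    image-γ : 0# ∉ b → image F g (γ F b) ≡ γ F (image F g b)
    image-γ {b} 0∉b = ≡-along (0∉image 0∉γ) 0∉γ λ {x} x≢0 → begin
      lookup (image F g (γ F b)) (g x) ≡⟨ lookup-image 0∉γ x≢0 ⟩
      lookup (γ F b) x                 ≡⟨ lookup-γ b x≢0 ⟩
      not (lookup b x)                 ≡⟨ cong not (sym (lookup-image 0∉b x≢0)) ⟩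
      not (lookup (image F g b) (g x)) ≡⟨ sym (lookup-γ (image F g b) (nonzero x≢0)) ⟩
      lookup (γ F (image F g b)) (g x) ∎

    g⁻¹ : Fin q → Fin q
    g⁻¹ y with y Fin.≟ 0#
    ... | yes _   = 0#
    ... | no  y≢0 = proj₁ (surjective y≢0)

    g⁻¹-inverse : y ≢ 0# → g⁻¹ y ≢ 0# × g (g⁻¹ y) ≡ y
    g⁻¹-inverse {y} y≢0 with y Fin.≟ 0#
    ... | yes y≡0 = contradiction y≡0 y≢0
    ... | no  y≢0 = proj₂ (surjective y≢0)

    g⁻¹∘g : x ≢ 0# → g⁻¹ (g x) ≡ x
    g⁻¹∘g x≢0 = let g⁻¹gx≢0 , gg⁻¹gx≡gx = g⁻¹-inverse (nonzero x≢0) in injective g⁻¹gx≢0 x≢0 gg⁻¹gx≡gx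

    extension : Permutation′ q
    extension = permutation (fixing0 g) (fixing0 g⁻¹)
      (fixing0-inverse (proj₁ ∘ g⁻¹-inverse) (proj₂ ∘ g⁻¹-inverse)) (fixing0-inverse nonzero g⁻¹∘g)

    ∣image∣ : 0# ∉ b → ∣ image F g b ∣ ≡ ∣ b ∣
    ∣image∣ {b} 0∉b = begin
      ∣ image F g b ∣                                 ≡⟨ sym (∣∣-permute (image F g b) extension) ⟩
      ∣ tabulate (lookup (image F g b) ∘ fixing0 g) ∣ ≡⟨ cong ∣_∣ (tabulate-cong pointwise) ⟩
      ∣ tabulate (lookup b) ∣                         ≡⟨ cong ∣_∣ (tabulate∘lookup b) ⟩
      ∣ b ∣                                           ∎
      where
      pointwise : ∀ x → lookup (image F g b) (fixing0 g x) ≡ lookup b x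
      pointwise x with x Fin.≟ 0#
      ... | yes refl = trans (∉⇒lookup≡false (0∉image 0∉b)) (sym (∉⇒lookup≡false 0∉b))
      ... | no  x≢0  = lookup-image 0∉b x≢0

module Orbits {q : ℕ} (F : FieldOn q) (ξ : XiParam F) where

  open FieldOn F using (0#)
  open PermutesF* (XiProperties.xiMap-permutes F ξ)
  open ≡-Reasoning

  g : Fin q → Fin q
  g = xiMap F ξ

  gⁿ : ℕ → Fin q → Fin q
  gⁿ = iter F g

  private variable
    x y z : Fin q
    m n : ℕ

  gⁿ-nonzero : ∀ k → x ≢ 0# → gⁿ k x ≢ 0#
  gⁿ-nonzero zero    x≢0 = x≢0
  gⁿ-nonzero (suc k) x≢0 = nonzero (gⁿ-nonzero k x≢0)

  gⁿ-+ : ∀ m n x → gⁿ (m ℕ.+ n) x ≡ gⁿ m (gⁿ n x)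
  gⁿ-+ zero    n x = refl
  gⁿ-+ (suc m) n x = cong g (gⁿ-+ m n x)

  gⁿ-comm : ∀ m n x → gⁿ m (gⁿ n x) ≡ gⁿ n (gⁿ m x)
  gⁿ-comm m n x = trans (sym (gⁿ-+ m n x)) (trans (cong (λ k → gⁿ k x) (ℕ.+-comm m n)) (gⁿ-+ n m x))

  gⁿ-∸ : m ≤ n → gⁿ (n ℕ.∸ m) (gⁿ m x) ≡ gⁿ n x
  gⁿ-∸ {m} {n} {x} m≤n = trans (sym (gⁿ-+ (n ℕ.∸ m) m x)) (cong (λ k → gⁿ k x) (ℕ.m∸n+n≡m m≤n))

  gⁿ-injective : ∀ k → x ≢ 0# → y ≢ 0# → gⁿ k x ≡ gⁿ k y → x ≡ y
  gⁿ-injective zero    _   _   x≡y = x≡y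
  gⁿ-injective (suc k) x≢0 y≢0 gᵏ⁺¹x≡gᵏ⁺¹y =
    gⁿ-injective k x≢0 y≢0 (injective (gⁿ-nonzero k x≢0) (gⁿ-nonzero k y≢0) gᵏ⁺¹x≡gᵏ⁺¹y)

  gⁿ-multiple : gⁿ n x ≡ x → ∀ k → gⁿ (k ℕ.* n) x ≡ x
  gⁿ-multiple gⁿx≡x zero = refl
  gⁿ-multiple {n} {x} gⁿx≡x (suc k) =
    trans (gⁿ-+ n (k ℕ.* n) x) (trans (cong (gⁿ n) (gⁿ-multiple gⁿx≡x k)) gⁿx≡x)

  period : x ≢ 0# → ∃[ p ] gⁿ (suc p) x ≡ x
  period {x} x≢0 with i , j , i<j , gⁱx≡gʲx ← pigeonhole (ℕ.n<1+n q) (λ (i : Fin (suc q)) → gⁿ (toℕ i) x)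
    = returnAfter (toℕ i) (toℕ j) i<j gⁱx≡gʲx
    where
    returnAfter : ∀ m n → m ℕ.< n → gⁿ m x ≡ gⁿ n x → ∃[ p ] gⁿ (suc p) x ≡ x
    returnAfter m (suc n) (s≤s m≤n) gᵐx≡gⁿ⁺¹x =
      n ℕ.∸ m , gⁿ-injective m (gⁿ-nonzero (suc (n ℕ.∸ m)) x≢0) x≢0 (begin
        gⁿ m (gⁿ (suc (n ℕ.∸ m)) x) ≡⟨ gⁿ-comm m (suc (n ℕ.∸ m)) x ⟩
        gⁿ (suc (n ℕ.∸ m)) (gⁿ m x) ≡⟨ cong (λ k → gⁿ k (gⁿ m x)) (sym (ℕ.+-∸-assoc 1 m≤n)) ⟩
        gⁿ (suc n ℕ.∸ m) (gⁿ m x)   ≡⟨ gⁿ-∸ (ℕ.m≤n⇒m≤1+n m≤n) ⟩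
        gⁿ (suc n) x                ≡⟨ sym gᵐx≡gⁿ⁺¹x ⟩
        gⁿ m x                      ∎)

  gⁿ-% : ∀ {p} → gⁿ (suc p) x ≡ x → ∀ k → gⁿ k x ≡ gⁿ (k % suc p) x
  gⁿ-% {x} {p} gᵖ⁺¹x≡x k = begin
    gⁿ k x                     ≡⟨ cong (λ k → gⁿ k x) (m≡m%n+[m/n]*n k (suc p)) ⟩
    gⁿ (r ℕ.+ d ℕ.* suc p) x    ≡⟨ gⁿ-+ r (d ℕ.* suc p) x ⟩
    gⁿ r (gⁿ (d ℕ.* suc p) x)   ≡⟨ cong (gⁿ r) (gⁿ-multiple gᵖ⁺¹x≡x d) ⟩
    gⁿ r x                     ∎
    where
    r = k % suc p
    d = k / suc p

  sameOrbit-gⁿ : m ≤ n → SameOrbit F ξ (gⁿ m x) (gⁿ n x)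
  sameOrbit-gⁿ {m} {n} m≤n = n ℕ.∸ m , gⁿ-∸ m≤n

  sameOrbit? : x ≢ 0# → ∀ y → Dec (SameOrbit F ξ x y)
  sameOrbit? {x} x≢0 y with p , gᵖ⁺¹x≡x ← period x≢0
    with any? (λ (j : Fin (suc p)) → gⁿ (toℕ j) x Fin.≟ y)
  ... | yes (j , gʲx≡y) = yes (toℕ j , gʲx≡y)
  ... | no  unreached   = no λ (k , gᵏx≡y) → let k%p+1<p+1 = m%n<n k (suc p) in
    unreached (fromℕ< k%p+1<p+1 , trans (cong (λ j → gⁿ j x) (toℕ-fromℕ< k%p+1<p+1))
                                        (trans (sym (gⁿ-% {p = p} gᵖ⁺¹x≡x k)) gᵏx≡y))

  sameOrbit-sym : x ≢ 0# → SameOrbit F ξ x y → SameOrbit F ξ y x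
  sameOrbit-sym {x} {y} x≢0 (k , gᵏx≡y) with p , gᵖ⁺¹x≡x ← period x≢0 =
    let r = k % suc p in suc p ℕ.∸ r , (begin
      gⁿ (suc p ℕ.∸ r) y        ≡⟨ cong (gⁿ (suc p ℕ.∸ r)) (trans (sym gᵏx≡y) (gⁿ-% gᵖ⁺¹x≡x k)) ⟩
      gⁿ (suc p ℕ.∸ r) (gⁿ r x) ≡⟨ gⁿ-∸ (ℕ.<⇒≤ (m%n<n k (suc p))) ⟩
      gⁿ (suc p) x              ≡⟨ gᵖ⁺¹x≡x ⟩
      x                         ∎)

  sameOrbit-trans : SameOrbit F ξ x y → SameOrbit F ξ y z → SameOrbit F ξ x z
  sameOrbit-trans {x} (k , gᵏx≡y) (l , gˡy≡z) =
    l ℕ.+ k , trans (gⁿ-+ l k x) (trans (cong (gⁿ l) gᵏx≡y) gˡy≡z)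

  orbits : ∃[ o ] HasCard (_≢ 0#) (SameOrbit F ξ) o
  orbits = hasCard nonzeros (λ (x , x≢0) → Any.map (λ x≡ → 0 , x≡) (∈-nonzeros x≢0))
    where
    open FieldProperties F using (nonzeros; ∈-nonzeros)
    open FiniteClasses (_≢ 0#) (SameOrbit F ξ) (λ _ → 0 , refl) sameOrbit-sym sameOrbit-trans sameOrbit?

  -- Either d is the least return time of x, i.e. an orbit length, or d splits into two
  -- shorter return times.
  returnTime-even : AllOrbitsEven F ξ → ∀ d → x ≢ 0# → gⁿ d x ≡ x → 2 ∣ d
  returnTime-even allEven d = <-rec (λ d → ∀ {x} → x ≢ 0# → gⁿ d x ≡ x → 2 ∣ d) step d
    where
    step : ∀ d → (∀ {e} → e ℕ.< d → ∀ {x} → x ≢ 0# → gⁿ e x ≡ x → 2 ∣ e) →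
           ∀ {x} → x ≢ 0# → gⁿ d x ≡ x → 2 ∣ d
    step zero    _   _   _ = divides 0 refl
    step (suc d) rec {x} x≢0 gᵈ⁺¹x≡x with any? (λ (j : Fin d) → gⁿ (suc (toℕ j)) x Fin.≟ x)
    ... | no earlierReturn = allEven x x≢0 (suc d) (s≤s z≤n , gᵈ⁺¹x≡x , minimal)
      where
      minimal : ∀ j → 1 ≤ j → j ℕ.< suc d → gⁿ j x ≢ x
      minimal (suc j) _ (s≤s j<d) gʲ⁺¹x≡x = earlierReturn
        (fromℕ< j<d , subst (λ j → gⁿ (suc j) x ≡ x) (sym (toℕ-fromℕ< j<d)) gʲ⁺¹x≡x)
    ... | yes (j , gᵉx≡x) = subst (2 ∣_) (ℕ.m+[n∸m]≡n e≤1+d)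
      (∣m∣n⇒∣m+n (rec (s≤s (toℕ<n j)) x≢0 gᵉx≡x) (rec (s≤s (ℕ.m∸n≤m d (toℕ j))) x≢0 gᵈ⁻ᵉ⁺¹x≡x))
      where
      e≤1+d : suc (toℕ j) ≤ suc d
      e≤1+d = ℕ.m≤n⇒m≤1+n (toℕ<n j)
      gᵈ⁻ᵉ⁺¹x≡x : gⁿ (d ℕ.∸ toℕ j) x ≡ x
      gᵈ⁻ᵉ⁺¹x≡x = trans (cong (gⁿ (d ℕ.∸ toℕ j)) (sym gᵉx≡x)) (trans (gⁿ-∸ e≤1+d) gᵈ⁺¹x≡x)

  notⁿ-returnTime : AllOrbitsEven F ξ → x ≢ 0# → m ≤ n → gⁿ m x ≡ gⁿ n x → ∀ t → notⁿ n t ≡ notⁿ m t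
  notⁿ-returnTime {x} {m} {n} allEven x≢0 m≤n gᵐx≡gⁿx t = begin
    notⁿ n t                  ≡⟨ cong (λ k → notⁿ k t) (sym (ℕ.m∸n+n≡m m≤n)) ⟩
    notⁿ (n ℕ.∸ m ℕ.+ m) t    ≡⟨ notⁿ-+ (n ℕ.∸ m) m t ⟩
    notⁿ (n ℕ.∸ m) (notⁿ m t) ≡⟨ notⁿ-even _ n-m-even ⟩
    notⁿ m t                  ∎
    where
    n-m-even : 2 ∣ n ℕ.∸ m
    n-m-even = returnTime-even allEven (n ℕ.∸ m) (gⁿ-nonzero m x≢0) (trans (gⁿ-∸ m≤n) (sym gᵐx≡gⁿx))

  notⁿ-respects-orbit : AllOrbitsEven F ξ → ∀ m n → x ≢ 0# → gⁿ m x ≡ gⁿ n x → ∀ t → notⁿ m t ≡ notⁿ n t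
  notⁿ-respects-orbit allEven m n x≢0 gᵐx≡gⁿx t with ℕ.≤-total m n
  ... | inj₁ m≤n = sym (notⁿ-returnTime allEven x≢0 m≤n gᵐx≡gⁿx t)
  ... | inj₂ n≤m = notⁿ-returnTime allEven x≢0 n≤m (sym gᵐx≡gⁿx) t

module FixedSets {q : ℕ} (F : FieldOn q) (ξ : XiParam F) where

  open FieldOn F using (0#)
  open SubsetsOfF* F
  open Orbits F ξ
  open ≡-Reasoning

  g-permutes : PermutesF* F g
  g-permutes = XiProperties.xiMap-permutes F ξ

  open PermutesF* g-permutes

  private variable
    b : Subset q
    x : Fin q

  Alternating : Subset q → Set
  Alternating b = ∀ {x} → x ≢ 0# → lookup b (g x) ≡ not (lookup b x)

  fixed⇒alternating : 0# ∉ b → actΞγ F ξ b ≡ b → Alternating b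
  fixed⇒alternating {b} 0∉b fixed {x} x≢0 = begin
    lookup b (g x)                   ≡⟨ cong (λ c → lookup c (g x)) (sym fixed) ⟩
    lookup (γ F (image F g b)) (g x) ≡⟨ lookup-γ (image F g b) (nonzero x≢0) ⟩
    not (lookup (image F g b) (g x)) ≡⟨ cong not (lookup-image g-permutes 0∉b x≢0) ⟩
    not (lookup b x)                 ∎

  alternating⇒fixed : 0# ∉ b → Alternating b → actΞγ F ξ b ≡ b
  alternating⇒fixed {b} 0∉b alternating = ≡-along g-permutes 0∉γ 0∉b λ {x} x≢0 → begin
    lookup (γ F (image F g b)) (g x) ≡⟨ lookup-γ (image F g b) (nonzero x≢0) ⟩
    not (lookup (image F g b) (g x)) ≡⟨ cong not (lookup-image g-permutes 0∉b x≢0) ⟩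
    not (lookup b x)                 ≡⟨ sym (alternating x≢0) ⟩
    lookup b (g x)                   ∎

  alternating-gⁿ : ∀ b → Alternating b → x ≢ 0# → ∀ k → lookup b (gⁿ k x) ≡ notⁿ k (lookup b x)
  alternating-gⁿ b alternating x≢0 zero    = refl
  alternating-gⁿ b alternating x≢0 (suc k) =
    trans (alternating (gⁿ-nonzero k x≢0)) (cong not (alternating-gⁿ b alternating x≢0 k))

  fixed⇒allOrbitsEven : 0# ∉ b → actΞγ F ξ b ≡ b → AllOrbitsEven F ξ
  fixed⇒allOrbitsEven {b} 0∉b fixed f f≢0 k (_ , gᵏf≡f , _) = notⁿ-fixed⇒even k (lookup b f)
    (trans (sym (alternating-gⁿ b (fixed⇒alternating 0∉b fixed) f≢0 k)) (cong (lookup b) gᵏf≡f))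

  fixed⇒InB : 0# ∉ b → actΞγ F ξ b ≡ b → InB F b
  fixed⇒InB {b} 0∉b fixed = 0∉b , sym (begin
    (q ℕ.∸ 1) / 2         ≡⟨ cong (_/ 2) (sym ∣b∣+∣b∣≡q-1) ⟩
    (∣ b ∣ ℕ.+ ∣ b ∣) / 2 ≡⟨ cong (_/ 2) (k+k≡k*2 ∣ b ∣) ⟩
    ∣ b ∣ ℕ.* 2 / 2       ≡⟨ m*n/n≡m ∣ b ∣ 2 ⟩
    ∣ b ∣                 ∎)
    where
    ∣b∣+∣b∣≡q-1 : ∣ b ∣ ℕ.+ ∣ b ∣ ≡ q ℕ.∸ 1
    ∣b∣+∣b∣≡q-1 = trans (cong₂ ℕ._+_ (cong ∣_∣ (sym fixed)) (sym (∣image∣ g-permutes 0∉b)))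
                        (∣γ∣+∣∣≡∣F*∣ (0∉image g-permutes 0∉b))

  module Colourings (allEven : AllOrbitsEven F ξ) {o}
                    (orbitReps : HasCard (_≢ 0#) (SameOrbit F ξ) o) where

    open HasCard orbitReps
      renaming (elem to rep; elem∈S to rep-nonzero; distinct to rep-distinct; cover to orbitOf)

    rep-unique : ∀ k m {i j} → x ≢ 0# → gⁿ k x ≡ rep i → gⁿ m x ≡ rep j → i ≡ j
    rep-unique k m {i} {j} x≢0 gᵏx≡repi gᵐx≡repj with ℕ.≤-total k m
    ... | inj₁ k≤m = rep-distinct i j (subst₂ (SameOrbit F ξ) gᵏx≡repi gᵐx≡repj (sameOrbit-gⁿ k≤m))
    ... | inj₂ m≤k = sym (rep-distinct j i (subst₂ (SameOrbit F ξ) gᵐx≡repj gᵏx≡repi (sameOrbit-gⁿ m≤k)))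

    colour : Vec Bool o → Fin q → Bool
    colour c x with x Fin.≟ 0#
    ... | yes _   = false
    ... | no  x≢0 = let i , k , _ = orbitOf x x≢0 in notⁿ k (lookup c i)

    colour-orbit : ∀ c k {i} → x ≢ 0# → gⁿ k x ≡ rep i → colour c x ≡ notⁿ k (lookup c i)
    colour-orbit {x} c k {i} x≢0 gᵏx≡repi with x Fin.≟ 0#
    ... | yes x≡0  = contradiction x≡0 x≢0
    ... | no  x≢0′ =
      let i′ , k′ , gᵏ′x≡repi′ = orbitOf x x≢0′
          i′≡i = rep-unique k′ k x≢0 gᵏ′x≡repi′ gᵏx≡repi
          gᵏ′x≡gᵏx = trans gᵏ′x≡repi′ (trans (cong rep i′≡i) (sym gᵏx≡repi))
      in trans (cong (λ j → notⁿ k′ (lookup c j)) i′≡i) (notⁿ-respects-orbit allEven k′ k x≢0 gᵏ′x≡gᵏx _)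

    colouring : Vec Bool o → Subset q
    colouring c = tabulate (colour c)

    colour-0 : ∀ c → colour c 0# ≡ false
    colour-0 c with 0# Fin.≟ 0#
    ... | yes _   = refl
    ... | no  0≢0 = contradiction refl 0≢0

    0∉colouring : ∀ {c} → 0# ∉ colouring c
    0∉colouring {c} 0∈colouring = contradiction
      (trans (sym ([]=⇒lookup 0∈colouring)) (trans (lookup∘tabulate (colour c) 0#) (colour-0 c))) λ ()

    colouring-alternating : ∀ c → Alternating (colouring c)
    colouring-alternating c {x} x≢0 = let i , k , gᵏgx≡repi = orbitOf (g x) (nonzero x≢0) in begin
      lookup (colouring c) (g x)      ≡⟨ lookup∘tabulate (colour c) (g x) ⟩
      colour c (g x)                  ≡⟨ colour-orbit c k (nonzero x≢0) gᵏgx≡repi ⟩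
      notⁿ k (lookup c i)             ≡⟨ sym (not-involutive _) ⟩
      not (notⁿ (suc k) (lookup c i)) ≡⟨ cong not (sym (colour-orbit c (suc k) x≢0
                                                          (trans (gⁿ-comm 1 k x) gᵏgx≡repi))) ⟩
      not (colour c x)                ≡⟨ cong not (sym (lookup∘tabulate (colour c) x)) ⟩
      not (lookup (colouring c) x)    ∎

    colouring-fixed : ∀ c → actΞγ F ξ (colouring c) ≡ colouring c
    colouring-fixed c = alternating⇒fixed 0∉colouring (colouring-alternating c)

    lookup-colouring-rep : ∀ c i → lookup (colouring c) (rep i) ≡ lookup c i
    lookup-colouring-rep c i =
      trans (lookup∘tabulate (colour c) (rep i)) (colour-orbit c 0 (rep-nonzero i) refl)

    colouring-injective : ∀ {c c′} → colouring c ≡ colouring c′ → c ≡ c′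
    colouring-injective {c} {c′} colouring≡ = lookup-extensional λ i → begin
      lookup c i                  ≡⟨ sym (lookup-colouring-rep c i) ⟩
      lookup (colouring c) (rep i)  ≡⟨ cong (λ b → lookup b (rep i)) colouring≡ ⟩
      lookup (colouring c′) (rep i) ≡⟨ lookup-colouring-rep c′ i ⟩
      lookup c′ i                   ∎

    fixed⇒colouring : 0# ∉ b → actΞγ F ξ b ≡ b → b ≡ colouring (tabulate (lookup b ∘ rep))
    fixed⇒colouring {b} 0∉b fixed = ≡-onF* 0∉b 0∉colouring λ {y} y≢0 →
      let i , k , gᵏy≡repi = orbitOf y y≢0 in begin
        lookup b y                   ≡⟨ sym (notⁿ-involutive k _) ⟩
        notⁿ k (notⁿ k (lookup b y)) ≡⟨ cong (notⁿ k) (sym (alternating-gⁿ b alternating y≢0 k)) ⟩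
        notⁿ k (lookup b (gⁿ k y))   ≡⟨ cong (λ z → notⁿ k (lookup b z)) gᵏy≡repi ⟩
        notⁿ k (lookup b (rep i))    ≡⟨ cong (notⁿ k) (sym (lookup∘tabulate (lookup b ∘ rep) i)) ⟩
        notⁿ k (lookup c i)          ≡⟨ sym (colour-orbit c k y≢0 gᵏy≡repi) ⟩
        colour c y                   ≡⟨ sym (lookup∘tabulate (colour c) y) ⟩
        lookup (colouring c) y       ∎
      where
      c = tabulate (lookup b ∘ rep)
      alternating = fixed⇒alternating 0∉b fixed

    fixedSets : HasCard (λ b → InB F b × actΞγ F ξ b ≡ b) _≡_ (2 ^ o)
    fixedSets = hasCard-↔ (Vec-Bool↔Fin-2^ o) colouring
      (λ c → fixed⇒InB 0∉colouring (colouring-fixed c) , colouring-fixed c)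
      colouring-injective
      (λ b ((0∉b , _) , fixed) → _ , fixed⇒colouring 0∉b fixed)

  allOrbitsEven⇒fixed : AllOrbitsEven F ξ → ∃[ b ] (InB F b × actΞγ F ξ b ≡ b)
  allOrbitsEven⇒fixed allEven =
    colouring c , fixed⇒InB 0∉colouring (colouring-fixed c) , colouring-fixed c
    where
    open Colourings allEven (proj₂ orbits)
    c = replicate (proj₁ orbits) false

module Words {q : ℕ} (F : FieldOn q) where

  open FieldOn F using (0#; 1#)
  open FieldProperties F using (1≢0)
  open SubsetsOfF* F
  open XiProperties F
  open ≡-Reasoning

  private variable
    b c : Subset q

  γ^ : Bool → Subset q → Subset q
  γ^ false c = c
  γ^ true  c = γ F c

  normalWord : Bool → XiParam F → Word F
  normalWord false ξ = genΞ ξ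
  normalWord true  ξ = genΞ ξ · genγ

  actW-normalWord : ∀ e ξ b → actW F (normalWord e ξ) b ≡ γ^ e (actΞ F ξ b)
  actW-normalWord false ξ b = refl
  actW-normalWord true  ξ b = refl

  normalForm : Word F → Bool × XiParam F
  normalForm idW      = false , idΞ
  normalForm (genΞ ξ) = false , ξ
  normalForm genγ     = true , idΞ
  normalForm (w · w′) = let e , ξ = normalForm w ; e′ , ξ′ = normalForm w′ in e xor e′ , ξ ⨾ ξ′

  0∉actΞ : ∀ ξ → 0# ∉ b → 0# ∉ actΞ F ξ b
  0∉actΞ ξ = 0∉image (xiMap-permutes ξ)

  0∉γ^ : ∀ e → 0# ∉ c → 0# ∉ γ^ e c
  0∉γ^ false 0∉c = 0∉c
  0∉γ^ true  _   = 0∉γ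

  γ^-γ^ : ∀ e e′ → 0# ∉ c → γ^ e′ (γ^ e c) ≡ γ^ (e xor e′) c
  γ^-γ^ false e′    _   = refl
  γ^-γ^ true  false _   = refl
  γ^-γ^ true  true  0∉c = γ-involutive 0∉c

  actΞ-γ^ : ∀ ξ e → 0# ∉ c → actΞ F ξ (γ^ e c) ≡ γ^ e (actΞ F ξ c)
  actΞ-γ^ ξ false _   = refl
  actΞ-γ^ ξ true  0∉c = image-γ (xiMap-permutes ξ) 0∉c

  actΞ-idΞ : 0# ∉ b → actΞ F idΞ b ≡ b
  actΞ-idΞ 0∉b = trans (image-cong 0∉b λ {x} _ → xiMap-idΞ x) image-id

  actΞ-⨾ : ∀ ξ η → 0# ∉ b → actΞ F η (actΞ F ξ b) ≡ actΞ F (ξ ⨾ η) b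
  actΞ-⨾ ξ η 0∉b = trans image-∘ (image-cong 0∉b λ x≢0 → sym (xiMap-⨾ ξ η x≢0))

  normalForm-correct : ∀ w → 0# ∉ b →
                       actW F w b ≡ γ^ (proj₁ (normalForm w)) (actΞ F (proj₂ (normalForm w)) b)
  normalForm-correct idW      0∉b = sym (actΞ-idΞ 0∉b)
  normalForm-correct (genΞ ξ) 0∉b = refl
  normalForm-correct genγ     0∉b = cong (γ F) (sym (actΞ-idΞ 0∉b))
  normalForm-correct {b} (w · w′) 0∉b = let e , ξ = normalForm w ; e′ , ξ′ = normalForm w′ in begin
    actW F w′ (actW F w b)                 ≡⟨ cong (actW F w′) (normalForm-correct w 0∉b) ⟩
    actW F w′ (γ^ e (actΞ F ξ b))          ≡⟨ normalForm-correct w′ (0∉γ^ e (0∉actΞ ξ 0∉b)) ⟩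
    γ^ e′ (actΞ F ξ′ (γ^ e (actΞ F ξ b)))  ≡⟨ cong (γ^ e′) (actΞ-γ^ ξ′ e (0∉actΞ ξ 0∉b)) ⟩
    γ^ e′ (γ^ e (actΞ F ξ′ (actΞ F ξ b)))  ≡⟨ γ^-γ^ e e′ (0∉actΞ ξ′ (0∉actΞ ξ 0∉b)) ⟩
    γ^ (e xor e′) (actΞ F ξ′ (actΞ F ξ b)) ≡⟨ cong (γ^ (e xor e′)) (actΞ-⨾ ξ ξ′ 0∉b) ⟩
    γ^ (e xor e′) (actΞ F (ξ ⨾ ξ′) b)      ∎

  normalForm-covers : ∀ w → ∃[ e ] ∃[ ξ ] _≈W_ F w (normalWord e ξ)
  normalForm-covers w = let e , ξ = normalForm w in
    e , ξ , λ b InBb → trans (normalForm-correct w (proj₁ InBb)) (sym (actW-normalWord e ξ b))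

  module Separation (5≤q : 5 ≤ q) where

    H : ℕ
    H = (q ℕ.∸ 1) / 2

    2≤H : 2 ≤ H
    2≤H = proj₁ (half-bounds q 5≤q)

    H≤q-2 : H ≤ q ℕ.∸ 2
    H≤q-2 = proj₂ (half-bounds q 5≤q)

    InB-between : ∀ {A C} → A ⊆ C → 0# ∉ C → ∣ A ∣ ≤ H → H ≤ ∣ C ∣ → ∃[ b ] (InB F b × A ⊆ b × b ⊆ C)
    InB-between {A} {C} A⊆C 0∉C ∣A∣≤H H≤∣C∣ =
      let b , A⊆b , b⊆C , ∣b∣≡H = ⊆-interpolate A C H A⊆C ∣A∣≤H H≤∣C∣
      in b , (0∉C ∘ b⊆C , ∣b∣≡H) , A⊆b , b⊆C

    ∣γ⁅x⁆∣ : ∀ {x} → x ≢ 0# → ∣ γ F ⁅ x ⁆ ∣ ≡ q ℕ.∸ 2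
    ∣γ⁅x⁆∣ {x} x≢0 = begin
      ∣ γ F ⁅ x ⁆ ∣                     ≡⟨ sym (ℕ.m+n∸n≡m _ 1) ⟩
      ∣ γ F ⁅ x ⁆ ∣ ℕ.+ 1 ℕ.∸ 1         ≡⟨ cong (λ k → ∣ γ F ⁅ x ⁆ ∣ ℕ.+ k ℕ.∸ 1) (sym (∣⁅x⁆∣≡1 x)) ⟩
      ∣ γ F ⁅ x ⁆ ∣ ℕ.+ ∣ ⁅ x ⁆ ∣ ℕ.∸ 1 ≡⟨ cong (ℕ._∸ 1) (∣γ∣+∣∣≡∣F*∣ (x≢0 ∘ sym ∘ x∈⁅y⁆⇒x≡y x)) ⟩
      q ℕ.∸ 1 ℕ.∸ 1                     ≡⟨ ℕ.∸-+-assoc q 1 1 ⟩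
      q ℕ.∸ 2                           ∎

    ⁅y⁆⊆γ⁅x⁆ : ∀ {x y} → y ≢ 0# → y ≢ x → ⁅ y ⁆ ⊆ γ F ⁅ x ⁆
    ⁅y⁆⊆γ⁅x⁆ {x} {y} y≢0 y≢x z∈⁅y⁆ with refl ← x∈⁅y⁆⇒x≡y y z∈⁅y⁆ = ∈γ⁺ y≢0 (y≢x ∘ x∈⁅y⁆⇒x≡y x)

    -- If ξ f ≢ η f, then x = η⁻¹ (ξ f) differs from f, and a member b of B that contains f
    -- but not x gives ξ f ∈ ξ(b) = η(b), forcing x ∈ b.
    actΞ-determines : ∀ ξ η → (∀ b → InB F b → actΞ F ξ b ≡ actΞ F η b) → _≈Ξ_ F ξ η
    actΞ-determines ξ η agree f f≢0 with xiMap F ξ f Fin.≟ xiMap F η f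
    ... | yes ξf≡ηf = ξf≡ηf
    ... | no  ξf≢ηf = let x , x≢0 , ηx≡ξf = η.surjective (ξ.nonzero f≢0) in
      ⊥-elim (separating x≢0 (λ x≡f → ξf≢ηf (trans (sym ηx≡ξf) (cong (xiMap F η) x≡f))) ηx≡ξf)
      where
      module ξ = PermutesF* (xiMap-permutes ξ)
      module η = PermutesF* (xiMap-permutes η)
      separating : ∀ {x} → x ≢ 0# → x ≢ f → xiMap F η x ≡ xiMap F ξ f → ⊥
      separating {x} x≢0 x≢f ηx≡ξf
        with b , InBb , ⁅f⁆⊆b , b⊆γ⁅x⁆ ← InB-between (⁅y⁆⊆γ⁅x⁆ f≢0 (x≢f ∘ sym)) 0∉γ
               (subst (_≤ H) (sym (∣⁅x⁆∣≡1 f)) (ℕ.≤-trans (s≤s z≤n) 2≤H))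
               (subst (H ≤_) (sym (∣γ⁅x⁆∣ x≢0)) H≤q-2)
        with y , by , ηy≡ξf ← image⁻ (subst (λ c → lookup c (xiMap F ξ f) ≡ true) (agree b InBb)
                                             (image⁺ ([]=⇒lookup (⁅f⁆⊆b (x∈⁅x⁆ f))) refl))
        with refl ← η.injective (lookup≡true⇒nonzero (proj₁ InBb) by) x≢0 (trans ηy≡ξf (sym ηx≡ξf))
        = ∈γ⁻ (b⊆γ⁅x⁆ (lookup⇒[]= y b by)) (x∈⁅x⁆ y)

    -- With x = η⁻¹ (ξ 1), a member b of B that contains 1 and x has ξ 1 = η x ∈ η(b), while
    -- ξ 1 ∈ ξ(b) = γ(η(b)).
    actΞ≢γ∘actΞ : ∀ ξ η → ¬ (∀ b → InB F b → actΞ F ξ b ≡ γ F (actΞ F η b))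
    actΞ≢γ∘actΞ ξ η agree = let x , x≢0 , ηx≡ξ1 = η.surjective ξ1≢0 in separated x≢0 ηx≡ξ1
      where
      module ξ = PermutesF* (xiMap-permutes ξ)
      module η = PermutesF* (xiMap-permutes η)
      ξ1≢0 = ξ.nonzero 1≢0
      separated : ∀ {x} → x ≢ 0# → xiMap F η x ≡ xiMap F ξ 1# → ⊥
      separated {x} x≢0 ηx≡ξ1
        with b , InBb , ⁅1⁆∪⁅x⁆⊆b , _ ← InB-between (⁅x⁆∪⁅y⁆⊆F* 1≢0 x≢0) 0∉F*
               (ℕ.≤-trans (∣⁅x⁆∪⁅y⁆∣≤2 1# x) 2≤H) (subst (H ≤_) (sym ∣F*∣) (m/n≤m (q ℕ.∸ 1) 2))
        = contradiction (begin
            true                                     ≡⟨ sym (image⁺ (∈b (inj₁ (x∈⁅x⁆ 1#))) refl) ⟩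
            lookup (actΞ F ξ b) (xiMap F ξ 1#)       ≡⟨ cong (λ c → lookup c _) (agree b InBb) ⟩
            lookup (γ F (actΞ F η b)) (xiMap F ξ 1#) ≡⟨ lookup-γ (actΞ F η b) ξ1≢0 ⟩
            not (lookup (actΞ F η b) (xiMap F ξ 1#)) ≡⟨ cong not (image⁺ (∈b (inj₂ (x∈⁅x⁆ x))) ηx≡ξ1) ⟩
            false                                    ∎) λ ()
        where
        ∈b : ∀ {y} → y ∈ ⁅ 1# ⁆ ⊎ y ∈ ⁅ x ⁆ → lookup b y ≡ true
        ∈b = []=⇒lookup ∘ ⁅1⁆∪⁅x⁆⊆b ∘ x∈p∪q⁺

    normalWord-injective : ∀ {e e′} ξ η → _≈W_ F (normalWord e ξ) (normalWord e′ η) → e ≡ e′ × _≈Ξ_ F ξ η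
    normalWord-injective {false} {false} ξ η agree = refl , actΞ-determines ξ η agree
    normalWord-injective {true}  {true}  ξ η agree = refl , actΞ-determines ξ η λ b InBb →
      trans (sym (γ-involutive (0∉actΞ ξ (proj₁ InBb))))
            (trans (cong (γ F) (agree b InBb)) (γ-involutive (0∉actΞ η (proj₁ InBb))))
    normalWord-injective {false} {true}  ξ η agree = ⊥-elim (actΞ≢γ∘actΞ ξ η agree)
    normalWord-injective {true}  {false} ξ η agree =
      ⊥-elim (actΞ≢γ∘actΞ η ξ λ b InBb → sym (agree b InBb))

    Ξ*-classes : ∀ {n} → HasCard (λ _ → ⊤) (_≈Ξ_ F) n → HasCard (λ _ → ⊤) (_≈W_ F) (2 ℕ.* n)
    Ξ*-classes Ξ-classes =
      hasCard-× (↔-sym 2↔Bool) normalWord Ξ-classes (normalWord-injective _ _) normalForm-covers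
        λ {w} {e} {ξ} {ξ′} w≈ξγᵉ ξ≈ξ′ b InBb → begin
          actW F w b                 ≡⟨ w≈ξγᵉ b InBb ⟩
          actW F (normalWord e ξ) b  ≡⟨ actW-normalWord e ξ b ⟩
          γ^ e (actΞ F ξ b)          ≡⟨ cong (γ^ e) (image-cong (proj₁ InBb) (ξ≈ξ′ _)) ⟩
          γ^ e (actΞ F ξ′ b)         ≡⟨ sym (actW-normalWord e ξ′ b) ⟩
          actW F (normalWord e ξ′) b ∎

open import Data.Nat using (_*_)

proposition3p3 : (q p k : ℕ) → Prime p → 1 ≤ k → q ≡ p ^ k → ¬ (2 ∣ q) → 5 ≤ q →
    (F : FieldOn q) →
    ((ξ : XiParam F) → ∀ b → InB F b → actΞ F ξ (γ F b) ≡ γ F (actΞ F ξ b))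
    × (∃[ n ] (HasCard {XiParam F} (λ _ → ⊤) (_≈Ξ_ F) n
               × HasCard {Word F} (λ _ → ⊤) (_≈W_ F) (2 * n)))
    × ((ξ : XiParam F) →
         (∃[ b ] (InB F b × actΞγ F ξ b ≡ b)) ⇔ AllOrbitsEven F ξ)
    × ((ξ : XiParam F) → AllOrbitsEven F ξ → (o : ℕ) →
         HasCard {Fin q} (λ f → f ≢ FieldOn.0# F) (SameOrbit F ξ) o →
         HasCard {Subset q} (λ b → InB F b × actΞγ F ξ b ≡ b) _≡_ (2 ^ o))
proposition3p3 q _ _ _ _ _ _ 5≤q F =
    (λ ξ b InBb → SubsetsOfF*.image-γ F (XiProperties.xiMap-permutes F ξ) (proj₁ InBb))
  , (let n , Ξ-classes = XiEnumeration.Ξ-classes F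
     in n , Ξ-classes , Separation.Ξ*-classes 5≤q Ξ-classes)
  , (λ ξ → mk⇔ (λ (b , (0∉b , _) , fixed) → FixedSets.fixed⇒allOrbitsEven F ξ 0∉b fixed)
               (FixedSets.allOrbitsEven⇒fixed F ξ))
  , (λ ξ allEven o orbitReps → FixedSets.Colourings.fixedSets F ξ allEven orbitReps)
  where open Words F using (module Separation)
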